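{- If a positive integer $n$ is nice and $m$ is a positive divisor of $n$, then $m$ is nice.
   Context: Two congruences $a \pmod{b}$ and $a' \pmod{b'}$ overlap if there is an integer $x$ with $x \equiv a \pmod{b}$ and $x \equiv a' \pmod{b'}$. A finite set of congruences $\{a_1 \pmod{d_1}, \ldots, a_t \pmod{d_t}\}$ with pairwise distinct moduli $1 \leq d_1 < \cdots < d_t$ is called good if whenever two distinct congruences $a_i \pmod{d_i}$ and $a_j \pmod{d_j}$ of the set overlap, we have $\gcd(d_i,d_j)=1$. A positive integer $n$ is called nice if there exist integers $a_d$, one for each divisor $d$ of $n$ with $d>1$, such that $\{a_d \pmod{d} : d \mid n, d>1\}$ is a good set of congruences. -}

module Defs where

open import Data.Nat using (ℕ; _<_; _>_)
open import Data.Nat.Divisibility using () renaming (_∣_ to _∣ℕ_)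
open import Data.Nat.GCD using (gcd)
open import Data.Integer using (ℤ; +_; _-_)
open import Data.Integer.Divisibility using (_∣_)
open import Data.Product using (∃; _×_)
open import Relation.Binary.PropositionalEquality using (_≡_; _≢_)

_≡_[mod_] : ℤ → ℤ → ℕ → Set
x ≡ a [mod b ] = (+ b) ∣ (x - a)

Overlap : ℤ → ℕ → ℤ → ℕ → Set
Overlap a b a' b' = ∃ λ (x : ℤ) → (x ≡ a [mod b ]) × (x ≡ a' [mod b' ])

-- n is nice: there is a choice of residue a_d for each divisor d > 1 of n
-- (given as a function ℕ → ℤ; only its values at divisors d > 1 matter)
-- such that the family {a_d mod d} is good: any two distinct members
-- (distinct moduli, since the moduli are the distinct divisors) that
-- overlap have coprime moduli.
Nice : ℕ → Set
Nice n = ∃ λ (a : ℕ → ℤ) →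
  ∀ d d' → d ∣ℕ n → d' ∣ℕ n → 1 < d → 1 < d' → d ≢ d' →
  Overlap (a d) d (a d') d' → gcd d d' ≡ 1

{-# OPTIONS --safe #-}
module Submission where

open import Defs
open import Data.Nat using (ℕ; _>_)
open import Data.Nat.Divisibility using (_∣_; ∣-trans)
open import Data.Product using (_,_)

Nice-∣ : {m n : ℕ} → m ∣ n → Nice n → Nice m
Nice-∣ m∣n (a , good) =
  a , λ d d' d∣m d'∣m → good d d' (∣-trans d∣m m∣n) (∣-trans d'∣m m∣n)

lemma1 : (n m : ℕ) → n > 0 → Nice n → m > 0 → m ∣ n → Nice m
lemma1 _ _ _ nice-n _ m∣n = Nice-∣ m∣n nice-n
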